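{- Let $n\ge3$, let $\mathfrak N$ be a $\big(\binom n2_{n-2}\binom n3_3\big)$-configuration on $\wp_2(I_n)$ such that the complete graph on $\{u\in\wp_2(I_n): n\in u\}$ is freely contained in $\mathfrak N$, and let $\mathfrak M=\Pi(n,\zeta_n,\mathfrak N)$. Define $\varrho\in\mathcal S_{\wp_2(I_n)}$ by: for distinct $i,j<n$, $\varrho^{ -1}(\{i,j\})$ is the unique $\{i',j'\}\subseteq I_{n-1}$ such that $\{\{i,n\},\{j,n\},\{i',j'\}\}$ is a line of $\mathfrak N$; and $\varrho^{ -1}(\{i,n\})=\{n-i,n\}$ for $i<n$. Let $\mathfrak K$ be the configuration on $\wp_2(I_n)$ whose lines are the lines of $\mathfrak N$ contained in $\wp_2(I_{n-1})$ together with the sets $\{\{i,n\},\{j,n\},\{j-i,j\}\}$ for $1\le i<j<n$. Then $\mathfrak M$ is isomorphic to $\Pi(n,\varrho,\mathfrak K)$, via the map sending (in $\Pi(n,\varrho,\mathfrak K)$, with points denoted $a'_i,b'_i,p',c'_u$) $p'\mapsto a_n$, $a'_i\mapsto a_i$ and $b'_i\mapsto c_{i,n}$ for $i<n$, $a'_n\mapsto p$, $b'_n\mapsto b_n$, $c'_{i,j}\mapsto c_{i,j}$ for $i,j<n$, and $c'_{i,n}\mapsto b_i$ for $i<n$.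
   Context: $I_m=\{1,\dots,m\}$, $\wp_k(X)$ the $k$-subsets of $X$, $\mathcal S_X$ the permutations of $X$. A $\big(\binom n2_{n-2}\binom n3_3\big)$-configuration: $\binom n2$ points each on $n-2$ lines, $\binom n3$ lines of size 3, two lines sharing at most one point. $\zeta_n(\{i,j\})=\{j-i,j\}$ for $1\le i<j\le n$. For $\sigma\in\mathcal S_{\wp_2(I_n)}$ and such $\mathfrak N$, $\Pi(n,\sigma,\mathfrak N)$ has pairwise distinct points $a_i,b_i$ ($i\in I_n$), $p$, $c_u$ ($u\in\wp_2(I_n)$; $c_{i,j}=c_{\{i,j\}}$) and lines $\{p,a_i,b_i\}$, $\{a_i,a_j,c_{\{i,j\}}\}$, $\{b_i,b_j,c_{\sigma^{ -1}(\{i,j\})}\}$, and $\{c_u,c_v,c_w\}$ for every line $\{u,v,w\}$ of $\mathfrak N$. A complete graph on a point set $Y$ is freely contained in a configuration if every $e\in\wp_2(Y)$ lies on a line $\overline e$, $e\mapsto\overline e$ is injective, and lines $\overline e,\overline{e'}$ with $e\cap e'=\emptyset$ do not meet. -}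

module Defs where

open import Data.Nat using (ℕ; zero; suc; _+_; _∸_; _≤_; _<_; z≤n; s≤s)
open import Data.Nat.Properties using (_≟_; _<?_; ≤∧≢⇒<; m<n⇒0<n∸m; ∸-monoʳ-<; m∸[m∸n]≡n; <⇒≤; ≤-refl; ≤-trans)
open import Data.Nat.Combinatorics using (_C_)
open import Data.Fin using (Fin)
open import Data.Product using (Σ; _×_; _,_)
open import Data.Sum using (_⊎_)
open import Data.Empty using (⊥)
open import Relation.Nullary using (¬_; yes; no; recompute)
open import Relation.Binary.PropositionalEquality using (_≡_; _≢_; refl)
open import Function.Bundles using (_↔_; Inverse; mk↔ₛ′)

-- I_n = {1,…,n}, and 2-subsets ℘₂(I_n) = {lo,hi} with 1 ≤ lo < hi ≤ n.
-- Proof fields are irrelevant, so elements/pairs are equal iff their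
-- numerical data are equal.

record Elem (n : ℕ) : Set where
  constructor elem
  field
    val : ℕ
    .pos : 1 ≤ val
    .bd  : val ≤ n
open Elem public

record Pair (n : ℕ) : Set where
  constructor pair
  field
    lo hi : ℕ
    .lo-pos : 1 ≤ lo
    .lo<hi  : lo < hi
    .hi-bd  : hi ≤ n
open Pair public

loE : ∀ {n} → Pair n → Elem n
loE (pair l h p q r) = elem l p (≤-trans (<⇒≤ q) r)

hiE : ∀ {n} → Pair n → Elem n
hiE (pair l h p q r) = elem h (≤-trans p (<⇒≤ q)) r

topE : (n : ℕ) → .(1 ≤ n) → Elem n
topE n h = elem n h ≤-refl

ζ : ∀ {n} → Pair n → Pair n
ζ (pair l h p q r) = pair (h ∸ l) h (m<n⇒0<n∸m q) (∸-monoʳ-< p (<⇒≤ q)) r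

pair≡ : ∀ {n} {u v : Pair n} → lo u ≡ lo v → hi u ≡ hi v → u ≡ v
pair≡ {u = pair l h _ _ _} {pair .l .h _ _ _} refl refl = refl

ζ-invol : ∀ {n} (u : Pair n) → ζ (ζ u) ≡ u
ζ-invol (pair l h p q r) = pair≡ (m∸[m∸n]≡n {h} {l} (<⇒≤ (recompute (l <? h) q))) refl

ζ↔ : (n : ℕ) → Pair n ↔ Pair n
ζ↔ n = mk↔ₛ′ ζ ζ ζ-invol ζ-invol

-- {x,y,z} given in any order: R holds of some reordering of (x,y,z).

Sym3 : ∀ {P : Set} → (P → P → P → Set) → P → P → P → Set
Sym3 R x y z = R x y z ⊎ R x z y ⊎ R y x z ⊎ R y z x ⊎ R z x y ⊎ R z y x

record Config (P : Set) : Set₁ where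
  field
    Line : Set
    pt₁ pt₂ pt₃ : Line → P
open Config public

_∈L_ : ∀ {P} {N : Config P} → P → Line N → Set
_∈L_ {N = N} x l = x ≡ pt₁ N l ⊎ x ≡ pt₂ N l ⊎ x ≡ pt₃ N l

IsLine : ∀ {P} → Config P → P → P → P → Set
IsLine N x y z =
  Σ (Line N) λ l → Sym3 (λ x′ y′ z′ → pt₁ N l ≡ x′ × pt₂ N l ≡ y′ × pt₃ N l ≡ z′) x y z

-- N is a ( C(n,2)_{n-2} C(n,3)_3 )-configuration on ℘₂(I_n)
-- (the C(n,2) points are all of Pair n).
IsConfiguration : (n : ℕ) → Config (Pair n) → Set
IsConfiguration n N =
  (∀ l → pt₁ N l ≢ pt₂ N l × pt₁ N l ≢ pt₃ N l × pt₂ N l ≢ pt₃ N l)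
  × (∀ l l′ → l ≢ l′ → ∀ x y → _∈L_ {N = N} x l → _∈L_ {N = N} y l
        → _∈L_ {N = N} x l′ → _∈L_ {N = N} y l′ → x ≡ y)
  × (Line N ↔ Fin (n C 3))
  × (∀ x → Σ (Line N) (λ l → _∈L_ {N = N} x l) ↔ Fin (n ∸ 2))

record Edge {P : Set} (Y : P → Set) : Set where
  constructor edge
  field
    e₁ e₂ : P
    in₁ : Y e₁
    in₂ : Y e₂
    distinct : e₁ ≢ e₂
open Edge public

SameEdge : ∀ {P} {Y : P → Set} → Edge Y → Edge Y → Set
SameEdge e e′ = (e₁ e ≡ e₁ e′ × e₂ e ≡ e₂ e′) ⊎ (e₁ e ≡ e₂ e′ × e₂ e ≡ e₁ e′)

DisjointEdge : ∀ {P} {Y : P → Set} → Edge Y → Edge Y → Set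
DisjointEdge e e′ = e₁ e ≢ e₁ e′ × e₁ e ≢ e₂ e′ × e₂ e ≢ e₁ e′ × e₂ e ≢ e₂ e′

FreelyContains : ∀ {P} → (N : Config P) → (Y : P → Set) → Set
FreelyContains N Y =
  Σ (Edge Y → Line N) λ f →
    (∀ e → _∈L_ {N = N} (e₁ e) (f e) × _∈L_ {N = N} (e₂ e) (f e))
    -- f is a well defined function of the 2-subset e
    × (∀ e e′ → SameEdge e e′ → f e ≡ f e′)
    × (∀ e e′ → f e ≡ f e′ → SameEdge e e′)
    × (∀ e e′ → DisjointEdge e e′ → ∀ x → _∈L_ {N = N} x (f e) → _∈L_ {N = N} x (f e′) → ⊥)

-- The configuration Π(n, σ, 𝔑); the lines of 𝔑 are given as a
-- predicate L on (unordered) triples.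

data Pt (n : ℕ) : Set where
  a b : Elem n → Pt n
  p   : Pt n
  c   : Pair n → Pt n

data ΠGen (n : ℕ) (σ : Pair n ↔ Pair n) (L : Pair n → Pair n → Pair n → Set)
          : Pt n → Pt n → Pt n → Set where
  pab : ∀ i → ΠGen n σ L p (a i) (b i)
  aac : ∀ u → ΠGen n σ L (a (loE u)) (a (hiE u)) (c u)
  bbc : ∀ u → ΠGen n σ L (b (loE u)) (b (hiE u)) (c (Inverse.from σ u))
  ccc : ∀ u v w → L u v w → ΠGen n σ L (c u) (c v) (c w)

ΠLine : (n : ℕ) → (σ : Pair n ↔ Pair n) → (Pair n → Pair n → Pair n → Set)
      → Pt n → Pt n → Pt n → Set
ΠLine n σ L = Sym3 (ΠGen n σ L)

RhoSpec : (n : ℕ) → Config (Pair n) → Pair n ↔ Pair n → Set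
RhoSpec n N ϱ =
  (∀ u u₁ u₂ → hi u < n
     → lo u₁ ≡ lo u → hi u₁ ≡ n → lo u₂ ≡ hi u → hi u₂ ≡ n
     → hi (Inverse.from ϱ u) < n × IsLine N u₁ u₂ (Inverse.from ϱ u))
  × (∀ u → hi u ≡ n
     → lo (Inverse.from ϱ u) ≡ n ∸ lo u × hi (Inverse.from ϱ u) ≡ n)

KSpecial : (n : ℕ) → Pair n → Pair n → Pair n → Set
KSpecial n x y z =
  Σ (Pair n) λ u →
    hi u < n × lo x ≡ lo u × hi x ≡ n × lo y ≡ hi u × hi y ≡ n × z ≡ ζ u

KLine : (n : ℕ) → Config (Pair n) → Pair n → Pair n → Pair n → Set
KLine n N x y z =
  (IsLine N x y z × hi x < n × hi y < n × hi z < n) ⊎ Sym3 (KSpecial n) x y z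

ψ : (n : ℕ) → .(1 ≤ n) → Pt n → Pt n
ψ n h p = a (topE n h)
ψ n h (a i) with val i ≟ n
... | yes _ = p
... | no  _ = a i
ψ n h (b (elem i q r)) with i ≟ n
... | yes _ = b (elem i q r)
... | no  ne = c (pair i n q (≤∧≢⇒< r ne) ≤-refl)
ψ n h (c u) with hi u ≟ n
... | yes _ = b (loE u)
... | no  _ = c u

-- Call a pair top if it contains n. Free containment forces every line of 𝔑 to contain zero or
-- two top pairs: not three, since the lines of the edges {x,y} and {x,z} would coincide, and not
-- exactly one, since that top pair would then lie on n - 1 lines (its n - 2 edge lines and this
-- one). Hence the line of the edge {{i,n},{j,n}} has a non-top third point, which is ϱ⁻¹{i,j}.
-- Distinct edges have distinct third points (edges sharing a vertex have lines meeting only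
-- there, disjoint edges have disjoint lines), so ϱ⁻¹ is an injection of the finite set ℘₂(I_n)
-- into itself and thus a permutation. The map ψ is an involution, and a case check over the four
-- kinds of lines, using this zero-or-two rule and the values of ζ and ϱ on top pairs, shows that
-- ψ maps lines of Π(n,ϱ,𝔎) to lines of Π(n,ζ,𝔑) and back.

module Submission where

open import Defs
open import Data.Nat using (ℕ; zero; suc; _+_; _∸_; _≤_; _<_; z≤n; s≤s)
open import Data.Nat.Properties
  using (_≟_; _<?_; _≤?_; ≤-trans; <-≤-trans; ≤∧≢⇒<; <⇒≤; ≤-refl; <⇒≢; <-trans; <-cmp;
         m≤n⇒m≤1+n; ≤-pred; 1+n≰n; suc-injective; m∸[m∸n]≡n; m+[n∸m]≡n)
open import Data.Fin using (Fin; zero; suc; toℕ; fromℕ<; punchIn; punchOut)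
open import Data.Fin.Properties
  using (any?; toℕ<n; toℕ-fromℕ<; toℕ-injective; injective⇒≤; punchOut-injective;
         punchIn-injective; punchInᵢ≢i; +↔⊎)
  renaming (_≟_ to _≟F_)
open import Data.Product using (Σ; _×_; _,_; proj₁; proj₂)
open import Data.Sum using (_⊎_; inj₁; inj₂)
open import Data.Sum.Function.Propositional using (_⊎-cong_)
open import Data.Empty using (⊥; ⊥-elim)
open import Function.Base using (case_of_)
open import Relation.Nullary using (¬_; Dec; yes; no; recompute)
open import Relation.Binary using (DecidableEquality; tri<; tri≈; tri>)
open import Relation.Binary.PropositionalEquality
  using (_≡_; _≢_; refl; sym; trans; cong; cong₂; subst; subst₂; ≢-sym)
open import Function.Bundles using (_↔_; _⇔_; Inverse; Injection; Bijection; mk↔ₛ′; mk⇔; mk⤖)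
open import Function.Definitions using (Injective; Bijective; StrictlySurjective)
open import Function.Consequences.Propositional using (strictlySurjective⇒surjective)
open import Function.Properties.Inverse using (↔-trans; ↔-sym; ↔⇒⤖; ↔⇒↣)
open import Function.Properties.Bijection using (⤖⇒↔)

module _ {P : Set} {R : P → P → P → Set} where

  sym3-swap₁₂ : ∀ {x y z} → Sym3 R x y z → Sym3 R y x z
  sym3-swap₁₂ (inj₁ r)                                = inj₂ (inj₂ (inj₁ r))
  sym3-swap₁₂ (inj₂ (inj₁ r))                         = inj₂ (inj₂ (inj₂ (inj₁ r)))
  sym3-swap₁₂ (inj₂ (inj₂ (inj₁ r)))                  = inj₁ r
  sym3-swap₁₂ (inj₂ (inj₂ (inj₂ (inj₁ r))))           = inj₂ (inj₁ r)
  sym3-swap₁₂ (inj₂ (inj₂ (inj₂ (inj₂ (inj₁ r)))))    = inj₂ (inj₂ (inj₂ (inj₂ (inj₂ r))))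
  sym3-swap₁₂ (inj₂ (inj₂ (inj₂ (inj₂ (inj₂ r)))))    = inj₂ (inj₂ (inj₂ (inj₂ (inj₁ r))))

  sym3-swap₂₃ : ∀ {x y z} → Sym3 R x y z → Sym3 R x z y
  sym3-swap₂₃ (inj₁ r)                                = inj₂ (inj₁ r)
  sym3-swap₂₃ (inj₂ (inj₁ r))                         = inj₁ r
  sym3-swap₂₃ (inj₂ (inj₂ (inj₁ r)))                  = inj₂ (inj₂ (inj₂ (inj₂ (inj₁ r))))
  sym3-swap₂₃ (inj₂ (inj₂ (inj₂ (inj₁ r))))           = inj₂ (inj₂ (inj₂ (inj₂ (inj₂ r))))
  sym3-swap₂₃ (inj₂ (inj₂ (inj₂ (inj₂ (inj₁ r)))))    = inj₂ (inj₂ (inj₁ r))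
  sym3-swap₂₃ (inj₂ (inj₂ (inj₂ (inj₂ (inj₂ r)))))    = inj₂ (inj₂ (inj₂ (inj₁ r)))

sym3-elim : ∀ {P : Set} {R : P → P → P → Set} (Q : P → P → P → Set)
  → (∀ {x y z} → Q x y z → Q y x z) → (∀ {x y z} → Q x y z → Q x z y)
  → (∀ {x y z} → R x y z → Q x y z)
  → ∀ {x y z} → Sym3 R x y z → Q x y z
sym3-elim Q s₁₂ s₂₃ k (inj₁ r)                             = k r
sym3-elim Q s₁₂ s₂₃ k (inj₂ (inj₁ r))                      = s₂₃ (k r)
sym3-elim Q s₁₂ s₂₃ k (inj₂ (inj₂ (inj₁ r)))               = s₁₂ (k r)
sym3-elim Q s₁₂ s₂₃ k (inj₂ (inj₂ (inj₂ (inj₁ r))))        = s₁₂ (s₂₃ (k r))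
sym3-elim Q s₁₂ s₂₃ k (inj₂ (inj₂ (inj₂ (inj₂ (inj₁ r))))) = s₂₃ (s₁₂ (k r))
sym3-elim Q s₁₂ s₂₃ k (inj₂ (inj₂ (inj₂ (inj₂ (inj₂ r))))) = s₁₂ (s₂₃ (s₁₂ (k r)))

sym3-map : ∀ {P Q : Set} {R : P → P → P → Set} {S : Q → Q → Q → Set} (f : P → Q)
  → (∀ {x y z} → R x y z → Sym3 S (f x) (f y) (f z))
  → ∀ {x y z} → Sym3 R x y z → Sym3 S (f x) (f y) (f z)
sym3-map {S = S} f =
  sym3-elim (λ x y z → Sym3 S (f x) (f y) (f z)) (sym3-swap₁₂ {R = S}) (sym3-swap₂₃ {R = S})

Sym3-resp : ∀ {P : Set} (R : P → P → P → Set) {x y z x′ y′ z′ : P}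
  → x′ ≡ x → y′ ≡ y → z′ ≡ z → Sym3 R x y z → Sym3 R x′ y′ z′
Sym3-resp R refl refl refl s = s

sym3-reverse : ∀ {P : Set} {R : P → P → P → Set} {x y z} → R z y x → Sym3 R x y z
sym3-reverse r = inj₂ (inj₂ (inj₂ (inj₂ (inj₂ r))))

Finite : Set → Set
Finite A = Σ ℕ λ k → A ↔ Fin k

Fin-injective⇒strictlySurjective : ∀ {k} (f : Fin k → Fin k)
  → Injective _≡_ _≡_ f → StrictlySurjective _≡_ f
Fin-injective⇒strictlySurjective f f-inj y with any? (λ x → f x ≟F y)
... | yes hit = hit
Fin-injective⇒strictlySurjective {suc k} f f-inj y | no miss =
  ⊥-elim (1+n≰n (injective⇒≤ f′-inj))
  where
  -- f misses y, so it factors injectively through Fin k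
  f′ : Fin (suc k) → Fin k
  f′ x = punchOut (λ y≡fx → miss (x , sym y≡fx))
  f′-inj : Injective _≡_ _≡_ f′
  f′-inj {x} {x′} eq = f-inj (punchOut-injective (λ e → miss (x , sym e)) (λ e → miss (x′ , sym e)) eq)

finite-injective⇒bijective : ∀ {A : Set} → Finite A → {f : A → A}
  → Injective _≡_ _≡_ f → Bijective _≡_ _≡_ f
finite-injective⇒bijective {A} (k , A↔Fin) {f} f-inj =
  f-inj , strictlySurjective⇒surjective onto
  where
  open Inverse A↔Fin using (to; from)
  to-inj : Injective _≡_ _≡_ to
  to-inj = Injection.injective (↔⇒↣ A↔Fin)
  from-inj : Injective _≡_ _≡_ from
  from-inj = Injection.injective (↔⇒↣ (↔-sym A↔Fin))
  F : Fin k → Fin k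
  F i = to (f (from i))
  onto : StrictlySurjective _≡_ f
  onto y with Fin-injective⇒strictlySurjective F (λ eq → from-inj (f-inj (to-inj eq))) (to y)
  ... | i , Fi≡y = from i , to-inj Fi≡y

elem≡ : ∀ {n} {x y : Elem n} → val x ≡ val y → x ≡ y
elem≡ {x = elem v _ _} {elem .v _ _} refl = refl

Elem↔Fin : ∀ n → Elem n ↔ Fin n
Elem↔Fin n = mk↔ₛ′ to from to∘from from∘to
  where
  to : Elem n → Fin n
  to (elem (suc v) _ v<n) = fromℕ< (recompute (suc v ≤? n) v<n)
  from : Fin n → Elem n
  from i = elem (suc (toℕ i)) (s≤s z≤n) (toℕ<n i)
  to∘from : ∀ i → to (from i) ≡ i
  to∘from i = toℕ-injective (toℕ-fromℕ< _)
  from∘to : ∀ x → from (to x) ≡ x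
  from∘to (elem (suc v) _ _) = elem≡ (cong suc (toℕ-fromℕ< _))

Pair-suc↔ : ∀ m → Pair (suc m) ↔ (Pair m ⊎ Elem m)
Pair-suc↔ m = mk↔ₛ′ to from to∘from from∘to
  where
  to : Pair (suc m) → Pair m ⊎ Elem m
  to (pair l k l-pos l<k k≤1+m) with k ≟ suc m
  ... | yes refl = inj₂ (elem l l-pos (≤-pred l<k))
  ... | no k≢1+m = inj₁ (pair l k l-pos l<k (≤-pred (≤∧≢⇒< k≤1+m k≢1+m)))
  from : Pair m ⊎ Elem m → Pair (suc m)
  from (inj₁ (pair l k l-pos l<k k≤m)) = pair l k l-pos l<k (m≤n⇒m≤1+n k≤m)
  from (inj₂ (elem l l-pos l≤m)) = pair l (suc m) l-pos (s≤s l≤m) ≤-refl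
  to∘from : ∀ y → to (from y) ≡ y
  to∘from (inj₁ (pair l k _ _ k≤m)) with k ≟ suc m
  ... | yes refl = ⊥-elim (1+n≰n (recompute (suc m ≤? m) k≤m))
  ... | no _ = refl
  to∘from (inj₂ _) with suc m ≟ suc m
  ... | yes refl = refl
  ... | no 1+m≢1+m = ⊥-elim (1+m≢1+m refl)
  from∘to : ∀ x → from (to x) ≡ x
  from∘to (pair l k _ _ _) with k ≟ suc m
  ... | yes refl = refl
  ... | no _ = refl

Pair0-empty : Pair 0 → ⊥
Pair0-empty (pair l k _ l<k k≤0) with recompute (l <? 0) (<-≤-trans l<k k≤0)
... | ()

Pair-finite : ∀ n → Finite (Pair n)
Pair-finite zero = 0 , mk↔ₛ′ (λ u → ⊥-elim (Pair0-empty u)) (λ ()) (λ ()) (λ u → ⊥-elim (Pair0-empty u))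
Pair-finite (suc m) with Pair-finite m
... | k , Pair↔Fin = k + m , ↔-trans (Pair-suc↔ m) (↔-trans (Pair↔Fin ⊎-cong Elem↔Fin m) (↔-sym +↔⊎))

_≟P_ : ∀ {n} → DecidableEquality (Pair n)
u ≟P v with lo u ≟ lo v | hi u ≟ hi v
... | yes lo≡ | yes hi≡ = yes (pair≡ lo≡ hi≡)
... | no lo≢  | _       = no (λ u≡v → lo≢ (cong lo u≡v))
... | yes _   | no hi≢  = no (λ u≡v → hi≢ (cong hi u≡v))

ζ-lo : ∀ {n} (u : Pair n) → lo (ζ u) ≡ hi u ∸ lo u
ζ-lo (pair _ _ _ _ _) = refl

ζ-hi : ∀ {n} (u : Pair n) → hi (ζ u) ≡ hi u
ζ-hi (pair _ _ _ _ _) = refl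

lo-pos′ : ∀ {n} (u : Pair n) → 1 ≤ lo u
lo-pos′ (pair l _ l-pos _ _) = recompute (1 ≤? l) l-pos

lo<hi′ : ∀ {n} (u : Pair n) → lo u < hi u
lo<hi′ (pair l k _ l<k _) = recompute (l <? k) l<k

hi≤n : ∀ {n} (u : Pair n) → hi u ≤ n
hi≤n {n} (pair _ k _ _ k≤n) = recompute (k ≤? n) k≤n

lo<n : ∀ {n} (u : Pair n) → lo u < n
lo<n u = <-≤-trans (lo<hi′ u) (hi≤n u)

lo≢n : ∀ {n} (u : Pair n) → lo u ≢ n
lo≢n u = <⇒≢ (lo<n u)

top : ∀ {n} (i : ℕ) → .(1 ≤ i) → .(i < n) → Pair n
top i i-pos i<n = pair i _ i-pos i<n ≤-refl

module Incidence {P : Set} (N : Config P) where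

  _∈_ : P → Line N → Set
  x ∈ l = _∈L_ {N = N} x l

  OnLine : Line N → P → P → P → Set
  OnLine l x′ y′ z′ = pt₁ N l ≡ x′ × pt₂ N l ≡ y′ × pt₃ N l ≡ z′

  IsLine-swap₁₂ : ∀ {x y z} → IsLine N x y z → IsLine N y x z
  IsLine-swap₁₂ (l , s) = l , sym3-swap₁₂ {R = OnLine l} s

  IsLine-swap₂₃ : ∀ {x y z} → IsLine N x y z → IsLine N x z y
  IsLine-swap₂₃ (l , s) = l , sym3-swap₂₃ {R = OnLine l} s

  IsLine-members : ∀ {x y z} ((l , _) : IsLine N x y z) → x ∈ l × y ∈ l × z ∈ l
  IsLine-members (l , s) =
    sym3-elim {R = OnLine l} (λ x y z → x ∈ l × y ∈ l × z ∈ l)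
      (λ (x∈ , y∈ , z∈) → y∈ , x∈ , z∈) (λ (x∈ , y∈ , z∈) → x∈ , z∈ , y∈)
      (λ { (refl , refl , refl) → inj₁ refl , inj₂ (inj₁ refl) , inj₂ (inj₂ refl) }) s

  IsLine-only : ∀ {x y z t} ((l , _) : IsLine N x y z) → t ∈ l → t ≡ x ⊎ t ≡ y ⊎ t ≡ z
  IsLine-only {t = t} (l , s) =
    sym3-elim {R = OnLine l} (λ x y z → t ∈ l → t ≡ x ⊎ t ≡ y ⊎ t ≡ z)
      (λ k t∈ → swap₁₂ (k t∈)) (λ k t∈ → swap₂₃ (k t∈)) (λ { (refl , refl , refl) t∈ → t∈ }) s
    where
    swap₁₂ : ∀ {x y z} → t ≡ x ⊎ t ≡ y ⊎ t ≡ z → t ≡ y ⊎ t ≡ x ⊎ t ≡ z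
    swap₁₂ (inj₁ e) = inj₂ (inj₁ e)
    swap₁₂ (inj₂ (inj₁ e)) = inj₁ e
    swap₁₂ (inj₂ (inj₂ e)) = inj₂ (inj₂ e)
    swap₂₃ : ∀ {x y z} → t ≡ x ⊎ t ≡ y ⊎ t ≡ z → t ≡ x ⊎ t ≡ z ⊎ t ≡ y
    swap₂₃ (inj₁ e) = inj₁ e
    swap₂₃ (inj₂ (inj₁ e)) = inj₂ (inj₂ e)
    swap₂₃ (inj₂ (inj₂ e)) = inj₂ (inj₁ e)

  third-point : ∀ {l x y} → x ∈ l → y ∈ l → x ≢ y → Σ P λ w → Sym3 (OnLine l) x y w
  third-point     (inj₁ refl)        (inj₁ refl)        x≢y = ⊥-elim (x≢y refl)
  third-point {l} (inj₁ refl)        (inj₂ (inj₁ refl)) _   =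
    pt₃ N l , inj₁ (refl , refl , refl)
  third-point {l} (inj₁ refl)        (inj₂ (inj₂ refl)) _   =
    pt₂ N l , inj₂ (inj₁ (refl , refl , refl))
  third-point {l} (inj₂ (inj₁ refl)) (inj₁ refl)        _   =
    pt₃ N l , inj₂ (inj₂ (inj₁ (refl , refl , refl)))
  third-point     (inj₂ (inj₁ refl)) (inj₂ (inj₁ refl)) x≢y = ⊥-elim (x≢y refl)
  third-point {l} (inj₂ (inj₁ refl)) (inj₂ (inj₂ refl)) _   =
    pt₁ N l , inj₂ (inj₂ (inj₂ (inj₂ (inj₁ (refl , refl , refl)))))
  third-point {l} (inj₂ (inj₂ refl)) (inj₁ refl)        _   =
    pt₂ N l , inj₂ (inj₂ (inj₂ (inj₁ (refl , refl , refl))))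
  third-point {l} (inj₂ (inj₂ refl)) (inj₂ (inj₁ refl)) _   =
    pt₁ N l , inj₂ (inj₂ (inj₂ (inj₂ (inj₂ (refl , refl , refl)))))
  third-point     (inj₂ (inj₂ refl)) (inj₂ (inj₂ refl)) x≢y = ⊥-elim (x≢y refl)

  module Linear
    (points-distinct : ∀ l → pt₁ N l ≢ pt₂ N l × pt₁ N l ≢ pt₃ N l × pt₂ N l ≢ pt₃ N l)
    (lines-meet-once : ∀ l l′ → l ≢ l′ → ∀ x y → x ∈ l → y ∈ l → x ∈ l′ → y ∈ l′ → x ≡ y)
    where

    IsLine-distinct : ∀ {x y z} → IsLine N x y z → x ≢ y × x ≢ z × y ≢ z
    IsLine-distinct (l , s) =
      sym3-elim {R = OnLine l} (λ x y z → x ≢ y × x ≢ z × y ≢ z)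
        (λ (x≢y , x≢z , y≢z) → ≢-sym x≢y , y≢z , x≢z) (λ (x≢y , x≢z , y≢z) → x≢z , x≢y , ≢-sym y≢z)
        (λ { (refl , refl , refl) → points-distinct l }) s

    same-line : ∀ {l l′ x y} → x ≢ y → x ∈ l → y ∈ l → x ∈ l′ → y ∈ l′ → ¬ ¬ (l ≡ l′)
    same-line {l} {l′} {x} {y} x≢y x∈l y∈l x∈l′ y∈l′ l≢l′ =
      x≢y (lines-meet-once l l′ l≢l′ x y x∈l y∈l x∈l′ y∈l′)

    third-point-unique : DecidableEquality P → ∀ {x y w w′} → IsLine N x y w → IsLine N x y w′ → w ≡ w′
    third-point-unique _≟_ {x} {y} {w} {w′} il il′ with w ≟ w′
    ... | yes w≡w′ = w≡w′
    ... | no w≢w′ = ⊥-elim (same-line x≢y x∈l y∈l x∈l′ y∈l′ λ l≡l′ →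
                      w′-elsewhere (IsLine-only il (subst (w′ ∈_) (sym l≡l′) w′∈l′)))
      where
      x∈l = proj₁ (IsLine-members il)
      y∈l = proj₁ (proj₂ (IsLine-members il))
      x∈l′ = proj₁ (IsLine-members il′)
      y∈l′ = proj₁ (proj₂ (IsLine-members il′))
      w′∈l′ = proj₂ (proj₂ (IsLine-members il′))
      x≢y = proj₁ (IsLine-distinct il)
      w′-elsewhere : w′ ≡ x ⊎ w′ ≡ y ⊎ w′ ≡ w → ⊥
      w′-elsewhere (inj₁ e) = proj₁ (proj₂ (IsLine-distinct il′)) (sym e)
      w′-elsewhere (inj₂ (inj₁ e)) = proj₂ (proj₂ (IsLine-distinct il′)) (sym e)
      w′-elsewhere (inj₂ (inj₂ e)) = w≢w′ (sym e)

module Involution (n : ℕ) (n≥1 : 1 ≤ n) where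

  ψₙ : Pt n → Pt n
  ψₙ = ψ n n≥1

  topOf : (i : Elem n) → val i ≢ n → Pair n
  topOf (elem i i-pos i≤n) ¬ti = top i i-pos (≤∧≢⇒< i≤n ¬ti)

  ψ-a-top : ∀ i → val i ≡ n → ψₙ (a i) ≡ p
  ψ-a-top i ti with val i ≟ n
  ... | yes _   = refl
  ... | no ¬ti = ⊥-elim (¬ti ti)

  ψ-a-low : ∀ i → val i ≢ n → ψₙ (a i) ≡ a i
  ψ-a-low i ¬ti with val i ≟ n
  ... | yes ti = ⊥-elim (¬ti ti)
  ... | no _   = refl

  ψ-b-top : ∀ i → val i ≡ n → ψₙ (b i) ≡ b i
  ψ-b-top (elem i _ _) ti with i ≟ n
  ... | yes _   = refl
  ... | no ¬ti = ⊥-elim (¬ti ti)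

  ψ-b-low : ∀ i (¬ti : val i ≢ n) → ψₙ (b i) ≡ c (topOf i ¬ti)
  ψ-b-low (elem i _ _) ¬ti with i ≟ n
  ... | yes ti = ⊥-elim (¬ti ti)
  ... | no _   = refl

  ψ-c-top : ∀ u → hi u ≡ n → ψₙ (c u) ≡ b (loE u)
  ψ-c-top u tu with hi u ≟ n
  ... | yes _   = refl
  ... | no ¬tu = ⊥-elim (¬tu tu)

  ψ-c-low : ∀ u → hi u ≢ n → ψₙ (c u) ≡ c u
  ψ-c-low u ¬tu with hi u ≟ n
  ... | yes tu = ⊥-elim (¬tu tu)
  ... | no _   = refl

  ψ-involutive : ∀ x → ψₙ (ψₙ x) ≡ x
  ψ-involutive p = ψ-a-top (topE n n≥1) refl
  ψ-involutive (a i) with val i ≟ n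
  ... | yes ti  = cong a (elem≡ (sym ti))
  ... | no ¬ti = ψ-a-low i ¬ti
  ψ-involutive (b i@(elem v _ _)) with v ≟ n
  ... | yes ti  = ψ-b-top i ti
  ... | no ¬ti = ψ-c-top (topOf i ¬ti) refl
  ψ-involutive (c u) with hi u ≟ n
  ... | yes tu  = trans (ψ-b-low (loE u) (lo≢n u)) (cong c (pair≡ refl (sym tu)))
  ... | no ¬tu = ψ-c-low u ¬tu

  ψ-bijective : Bijective _≡_ _≡_ ψₙ
  ψ-bijective = Bijection.bijective (↔⇒⤖ (mk↔ₛ′ ψₙ ψₙ ψ-involutive ψ-involutive))

  module _ (σ : Pair n ↔ Pair n) (L : Pair n → Pair n → Pair n → Set) where

    ψ-preserves-pab : ∀ i → ΠLine n σ L (ψₙ p) (ψₙ (a i)) (ψₙ (b i))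
    ψ-preserves-pab i@(elem v _ _) = case v ≟ n of λ where
      (yes ti)  → Sym3-resp (ΠGen n σ L) (cong a (elem≡ (sym ti))) (ψ-a-top i ti) (ψ-b-top i ti)
                    (sym3-swap₁₂ {R = ΠGen n σ L} (inj₁ (pab i)))
      (no ¬ti) → Sym3-resp (ΠGen n σ L) refl (ψ-a-low i ¬ti) (ψ-b-low i ¬ti)
                    (sym3-swap₁₂ {R = ΠGen n σ L} (inj₁ (aac (topOf i ¬ti))))

    ψ-preserves-aac : ∀ u → ΠLine n σ L (ψₙ (a (loE u))) (ψₙ (a (hiE u))) (ψₙ (c u))
    ψ-preserves-aac u = case hi u ≟ n of λ where
      (yes tu)  → Sym3-resp (ΠGen n σ L) (ψ-a-low (loE u) (lo≢n u)) (ψ-a-top (hiE u) tu) (ψ-c-top u tu)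
                    (sym3-swap₁₂ {R = ΠGen n σ L} (inj₁ (pab (loE u))))
      (no ¬tu) → Sym3-resp (ΠGen n σ L) (ψ-a-low (loE u) (lo≢n u)) (ψ-a-low (hiE u) ¬tu) (ψ-c-low u ¬tu)
                    (inj₁ (aac u))

module TopPairs (n : ℕ) (h : 3 ≤ n) (N : Config (Pair n))
  (conf : IsConfiguration n N) (free : FreelyContains N (λ u → hi u ≡ n)) where

  open Incidence N
  open Linear (proj₁ conf) (proj₁ (proj₂ conf))

  Top : Pair n → Set
  Top u = hi u ≡ n

  lines-meet-once : ∀ l l′ → l ≢ l′ → ∀ x y → x ∈ l → y ∈ l → x ∈ l′ → y ∈ l′ → x ≡ y
  lines-meet-once = proj₁ (proj₂ conf)

  lines-through : ∀ x → Σ (Line N) (x ∈_) ↔ Fin (n ∸ 2)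
  lines-through = proj₂ (proj₂ (proj₂ conf))

  edgeLine : Edge Top → Line N
  edgeLine = proj₁ free

  edgeLine-covers : ∀ e → e₁ e ∈ edgeLine e × e₂ e ∈ edgeLine e
  edgeLine-covers = proj₁ (proj₂ free)

  edgeLine-injective : ∀ e e′ → edgeLine e ≡ edgeLine e′ → SameEdge e e′
  edgeLine-injective = proj₁ (proj₂ (proj₂ (proj₂ free)))

  edgeLine-disjoint : ∀ e e′ → DisjointEdge e e′ → ∀ x → x ∈ edgeLine e → x ∈ edgeLine e′ → ⊥
  edgeLine-disjoint = proj₂ (proj₂ (proj₂ (proj₂ free)))

  ¬Top⇒hi<n : ∀ u → ¬ Top u → hi u < n
  ¬Top⇒hi<n u = ≤∧≢⇒< (hi≤n u)

  ¬three-top : ∀ {x y z} → IsLine N x y z → Top x → Top y → Top z → ⊥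
  ¬three-top {x} {y} {z} il tx ty tz =
    same-line x≢y x∈l y∈l (proj₁ (edgeLine-covers xy)) (proj₂ (edgeLine-covers xy)) λ l≡xy →
    same-line x≢z x∈l z∈l (proj₁ (edgeLine-covers xz)) (proj₂ (edgeLine-covers xz)) λ l≡xz →
    different-edges (edgeLine-injective xy xz (trans (sym l≡xy) l≡xz))
    where
    x∈l = proj₁ (IsLine-members il)
    y∈l = proj₁ (proj₂ (IsLine-members il))
    z∈l = proj₂ (proj₂ (IsLine-members il))
    x≢y = proj₁ (IsLine-distinct il)
    x≢z = proj₁ (proj₂ (IsLine-distinct il))
    y≢z = proj₂ (proj₂ (IsLine-distinct il))
    xy = edge x y tx ty x≢y
    xz = edge x z tx tz x≢z
    different-edges : SameEdge xy xz → ⊥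
    different-edges (inj₁ (_ , y≡z)) = y≢z y≡z
    different-edges (inj₂ (x≡z , _)) = x≢z x≡z

  2+[n∸2]≡n : 2 + (n ∸ 2) ≡ n
  2+[n∸2]≡n = m+[n∸m]≡n (≤-trans (s≤s (s≤s z≤n)) h)

  topAt : Fin (suc (n ∸ 2)) → Pair n
  topAt k = top (suc (toℕ k)) (s≤s z≤n) (subst (suc (toℕ k) <_) 2+[n∸2]≡n (s≤s (toℕ<n k)))

  topAt-injective : Injective _≡_ _≡_ topAt
  topAt-injective eq = toℕ-injective (suc-injective (cong lo eq))

  topAt-onto : ∀ u → Top u → Σ (Fin (suc (n ∸ 2))) λ k → topAt k ≡ u
  topAt-onto (pair (suc l) _ _ l<n _) refl = fromℕ< l<1+[n∸2] , pair≡ (cong suc (toℕ-fromℕ< _)) refl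
    where
    l<1+[n∸2] : l < suc (n ∸ 2)
    l<1+[n∸2] = ≤-pred (subst (suc l <_) (sym 2+[n∸2]≡n) (recompute (suc l <? n) l<n))

  ¬one-top : ∀ {x y z} → IsLine N x y z → Top x → ¬ Top y → ¬ Top z → ⊥
  ¬one-top {x} il tx ¬ty ¬tz with topAt-onto x tx
  ... | i , refl = 1+n≰n (injective⇒≤ (λ eq → lineAt-injective (to-injective eq)))
    where
    open Inverse (lines-through (topAt i)) using (to)
    to-injective : Injective _≡_ _≡_ to
    to-injective = Injection.injective (↔⇒↣ (lines-through (topAt i)))
    edgeTo : Fin (n ∸ 2) → Edge Top
    edgeTo k = edge (topAt i) (topAt (punchIn i k)) refl refl
                    (λ eq → punchInᵢ≢i i k (sym (topAt-injective eq)))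
    l≢edgeLine : ∀ k → proj₁ il ≢ edgeLine (edgeTo k)
    l≢edgeLine k l≡ with IsLine-only il (subst (topAt (punchIn i k) ∈_) (sym l≡)
                                                (proj₂ (edgeLine-covers (edgeTo k))))
    ... | inj₁ eq = punchInᵢ≢i i k (topAt-injective eq)
    ... | inj₂ (inj₁ eq) = ¬ty (subst Top eq refl)
    ... | inj₂ (inj₂ eq) = ¬tz (subst Top eq refl)
    lineAt : Fin (suc (n ∸ 2)) → Σ (Line N) (topAt i ∈_)
    lineAt zero = proj₁ il , proj₁ (IsLine-members il)
    lineAt (suc k) = edgeLine (edgeTo k) , proj₁ (edgeLine-covers (edgeTo k))
    lineAt-injective : Injective _≡_ _≡_ lineAt
    lineAt-injective {zero} {zero} _ = refl
    lineAt-injective {zero} {suc k} eq = ⊥-elim (l≢edgeLine k (cong proj₁ eq))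
    lineAt-injective {suc k} {zero} eq = ⊥-elim (l≢edgeLine k (sym (cong proj₁ eq)))
    lineAt-injective {suc k} {suc k′} eq with edgeLine-injective (edgeTo k) (edgeTo k′) (cong proj₁ eq)
    ... | inj₁ (_ , eq₂) = cong suc (punchIn-injective i k k′ (topAt-injective eq₂))
    ... | inj₂ (eq₁ , _) = ⊥-elim (punchInᵢ≢i i k′ (sym (topAt-injective eq₁)))

  topLo : Pair n → Pair n
  topLo u = top (lo u) (lo-pos′ u) (lo<n u)

  topHi : (u : Pair n) → ¬ Top u → Pair n
  topHi u ¬tu = top (hi u) (≤-trans (lo-pos′ u) (<⇒≤ (lo<hi′ u))) (¬Top⇒hi<n u ¬tu)

  lowEdge : (u : Pair n) → ¬ Top u → Edge Top
  lowEdge u ¬tu = edge (topLo u) (topHi u ¬tu) refl refl (λ eq → <⇒≢ (lo<hi′ u) (cong lo eq))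

  edgeThird : (e : Edge Top) → Σ (Pair n) (Sym3 (OnLine (edgeLine e)) (e₁ e) (e₂ e))
  edgeThird e = third-point (proj₁ (edgeLine-covers e)) (proj₂ (edgeLine-covers e)) (distinct e)

  opposite : (u : Pair n) → ¬ Top u → Pair n
  opposite u ¬tu = proj₁ (edgeThird (lowEdge u ¬tu))

  opposite-line : ∀ u ¬tu → IsLine N (topLo u) (topHi u ¬tu) (opposite u ¬tu)
  opposite-line u ¬tu = edgeLine (lowEdge u ¬tu) , proj₂ (edgeThird (lowEdge u ¬tu))

  opposite-low : ∀ u ¬tu → ¬ Top (opposite u ¬tu)
  opposite-low u ¬tu = ¬three-top (opposite-line u ¬tu) refl refl

  lowEdge-lines-differ : ∀ u v ¬tu ¬tv → u ≢ v → edgeLine (lowEdge u ¬tu) ≢ edgeLine (lowEdge v ¬tv)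
  lowEdge-lines-differ u v ¬tu ¬tv u≢v lu≡lv with edgeLine-injective (lowEdge u ¬tu) (lowEdge v ¬tv) lu≡lv
  ... | inj₁ (lo≡lo , hi≡hi) = u≢v (pair≡ (cong lo lo≡lo) (cong lo hi≡hi))
  ... | inj₂ (lo≡hi , hi≡lo) =
    1+n≰n (<-trans (subst (lo u <_) (cong lo hi≡lo) (lo<hi′ u))
                   (subst (lo v <_) (sym (cong lo lo≡hi)) (lo<hi′ v)))

  opposite-injective : ∀ u v ¬tu ¬tv → opposite u ¬tu ≡ opposite v ¬tv → u ≡ v
  opposite-injective u v ¬tu ¬tv eq with u ≟P v
  ... | yes u≡v = u≡v
  ... | no u≢v = ⊥-elim lines-meet
    where
    eu = lowEdge u ¬tu
    ev = lowEdge v ¬tv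
    lu = edgeLine eu
    lv = edgeLine ev
    w = opposite u ¬tu
    e₁∈ : ∀ e → e₁ e ∈ edgeLine e
    e₁∈ e = proj₁ (edgeLine-covers e)
    e₂∈ : ∀ e → e₂ e ∈ edgeLine e
    e₂∈ e = proj₂ (edgeLine-covers e)
    w∈lu : w ∈ lu
    w∈lu = proj₂ (proj₂ (IsLine-members (opposite-line u ¬tu)))
    w∈lv : w ∈ lv
    w∈lv = subst (_∈ lv) (sym eq) (proj₂ (proj₂ (IsLine-members (opposite-line v ¬tv))))
    lu≢lv : lu ≢ lv
    lu≢lv = lowEdge-lines-differ u v ¬tu ¬tv u≢v
    ¬shared : ∀ t → Top t → t ∈ lu → t ∈ lv → ⊥
    ¬shared t tt t∈lu t∈lv =
      opposite-low u ¬tu (subst Top (lines-meet-once lu lv lu≢lv t w t∈lu w∈lu t∈lv w∈lv) tt)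
    lines-meet : ⊥
    lines-meet with topLo u ≟P topLo v | topLo u ≟P topHi v ¬tv
                  | topHi u ¬tu ≟P topLo v | topHi u ¬tu ≟P topHi v ¬tv
    ... | yes e | _ | _ | _ = ¬shared (topLo u) refl (e₁∈ eu) (subst (_∈ lv) (sym e) (e₁∈ ev))
    ... | no _ | yes e | _ | _ = ¬shared (topLo u) refl (e₁∈ eu) (subst (_∈ lv) (sym e) (e₂∈ ev))
    ... | no _ | no _ | yes e | _ = ¬shared (topHi u ¬tu) refl (e₂∈ eu) (subst (_∈ lv) (sym e) (e₁∈ ev))
    ... | no _ | no _ | no _ | yes e = ¬shared (topHi u ¬tu) refl (e₂∈ eu) (subst (_∈ lv) (sym e) (e₂∈ ev))
    ... | no d₁ | no d₂ | no d₃ | no d₄ = edgeLine-disjoint eu ev (d₁ , d₂ , d₃ , d₄) w w∈lu w∈lv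

  ϱ⁻¹ : Pair n → Pair n
  ϱ⁻¹ u with hi u ≟ n
  ... | yes _   = ζ u
  ... | no ¬tu = opposite u ¬tu

  ϱ⁻¹-injective : Injective _≡_ _≡_ ϱ⁻¹
  ϱ⁻¹-injective {u} {v} eq with hi u ≟ n | hi v ≟ n
  ... | yes _  | yes _   = trans (sym (ζ-invol u)) (trans (cong ζ eq) (ζ-invol v))
  ... | yes tu | no ¬tv = ⊥-elim (opposite-low v ¬tv (subst Top eq (trans (ζ-hi u) tu)))
  ... | no ¬tu | yes tv = ⊥-elim (opposite-low u ¬tu (subst Top (sym eq) (trans (ζ-hi v) tv)))
  ... | no ¬tu | no ¬tv = opposite-injective u v ¬tu ¬tv eq

  ϱ : Pair n ↔ Pair n
  ϱ = ↔-sym (⤖⇒↔ (mk⤖ (finite-injective⇒bijective (Pair-finite n) ϱ⁻¹-injective)))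

  ϱ-spec : RhoSpec n N ϱ
  ϱ-spec = low , top-case
    where
    low : ∀ u u₁ u₂ → hi u < n → lo u₁ ≡ lo u → hi u₁ ≡ n → lo u₂ ≡ hi u → hi u₂ ≡ n
        → hi (ϱ⁻¹ u) < n × IsLine N u₁ u₂ (ϱ⁻¹ u)
    low u u₁ u₂ hu<n lo₁ hi₁ lo₂ hi₂ with hi u ≟ n
    ... | yes tu  = ⊥-elim (<⇒≢ hu<n tu)
    ... | no ¬tu = ¬Top⇒hi<n (opposite u ¬tu) (opposite-low u ¬tu)
                 , subst₂ (λ x y → IsLine N x y (opposite u ¬tu))
                          (pair≡ (sym lo₁) (sym hi₁)) (pair≡ (sym lo₂) (sym hi₂)) (opposite-line u ¬tu)
    top-case : ∀ u → hi u ≡ n → lo (ϱ⁻¹ u) ≡ n ∸ lo u × hi (ϱ⁻¹ u) ≡ n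
    top-case u tu with hi u ≟ n
    ... | yes _   = trans (ζ-lo u) (cong (_∸ lo u) tu) , trans (ζ-hi u) tu
    ... | no ¬tu = ⊥-elim (¬tu tu)

module Correspondence (n : ℕ) (h : 3 ≤ n) (N : Config (Pair n))
  (conf : IsConfiguration n N) (free : FreelyContains N (λ u → hi u ≡ n))
  (ϱ : Pair n ↔ Pair n) (spec : RhoSpec n N ϱ) where

  open Incidence N using (IsLine-swap₁₂; IsLine-swap₂₃)
  open Incidence.Linear N (proj₁ conf) (proj₁ (proj₂ conf)) using (IsLine-distinct; third-point-unique)
  open TopPairs n h N conf free using (Top; ¬Top⇒hi<n; ¬three-top; ¬one-top)
  open Involution n (≤-trans (s≤s z≤n) h)
  open Inverse ϱ using () renaming (from to ϱ⁻¹)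

  K : Pt n → Pt n → Pt n → Set
  K = ΠGen n ϱ (KLine n N)

  Z : Pt n → Pt n → Pt n → Set
  Z = ΠGen n (ζ↔ n) (IsLine N)

  ψ-maps-K-bbc : ∀ u → Dec (Top u) → Sym3 Z (ψₙ (b (loE u))) (ψₙ (b (hiE u))) (ψₙ (c (ϱ⁻¹ u)))
  ψ-maps-K-bbc u (yes tu) =
    Sym3-resp Z (trans (ψ-b-low (loE u) (lo≢n u)) (cong c (pair≡ (sym lo-ζw) (sym (trans (ζ-hi w) hi-w)))))
                (trans (ψ-b-top (hiE u) tu) (cong b (elem≡ (trans tu (sym hi-w)))))
                (ψ-c-top w hi-w)
                (sym3-reverse {R = Z} (bbc w))
    where
    w = ϱ⁻¹ u
    lo-w = proj₁ (proj₂ spec u tu)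
    hi-w = proj₂ (proj₂ spec u tu)
    lo-ζw : lo (ζ w) ≡ lo u
    lo-ζw = trans (ζ-lo w) (trans (cong₂ _∸_ hi-w lo-w) (m∸[m∸n]≡n (<⇒≤ (lo<n u))))
  ψ-maps-K-bbc u (no ¬tu) =
    Sym3-resp Z (ψ-b-low (loE u) (lo≢n u)) (ψ-b-low (hiE u) ¬tu) (ψ-c-low w (<⇒≢ (proj₁ w-line)))
                (inj₁ (ccc _ _ w (proj₂ w-line)))
    where
    w = ϱ⁻¹ u
    w-line = proj₁ spec u (topOf (loE u) (lo≢n u)) (topOf (hiE u) ¬tu) (¬Top⇒hi<n u ¬tu) refl refl refl refl

  ψ-maps-special : ∀ {x y z} → KSpecial n x y z → Sym3 Z (ψₙ (c x)) (ψₙ (c y)) (ψₙ (c z))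
  ψ-maps-special {x} {y} (u , hu<n , lo-x , hi-x , lo-y , hi-y , refl) =
    Sym3-resp Z (trans (ψ-c-top x hi-x) (cong b (elem≡ lo-x)))
                (trans (ψ-c-top y hi-y) (cong b (elem≡ lo-y)))
                (ψ-c-low (ζ u) (λ e → <⇒≢ hu<n (trans (sym (ζ-hi u)) e)))
                (inj₁ (bbc u))

  ψ-maps-K-lines : ∀ {x y z} → K x y z → Sym3 Z (ψₙ x) (ψₙ y) (ψₙ z)
  ψ-maps-K-lines (pab i) = ψ-preserves-pab (ζ↔ n) (IsLine N) i
  ψ-maps-K-lines (aac u) = ψ-preserves-aac (ζ↔ n) (IsLine N) u
  ψ-maps-K-lines (bbc u) = ψ-maps-K-bbc u (hi u ≟ n)
  ψ-maps-K-lines (ccc u v w (inj₁ (il , hu<n , hv<n , hw<n))) =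
    Sym3-resp Z (ψ-c-low u (<⇒≢ hu<n)) (ψ-c-low v (<⇒≢ hv<n)) (ψ-c-low w (<⇒≢ hw<n)) (inj₁ (ccc u v w il))
  ψ-maps-K-lines (ccc u v w (inj₂ special)) =
    sym3-map {R = KSpecial n} {S = Z} (λ q → ψₙ (c q)) ψ-maps-special special

  ψ-maps-Z-bbc : ∀ u → Dec (Top u) → Sym3 K (ψₙ (b (loE u))) (ψₙ (b (hiE u))) (ψₙ (c (ζ u)))
  ψ-maps-Z-bbc u (yes tu) =
    Sym3-resp K (trans (ψ-b-low (loE u) (lo≢n u)) (cong c (pair≡ (sym lo-ϱ⁻¹v) (sym hi-ϱ⁻¹v))))
                (trans (ψ-b-top (hiE u) tu) (cong b (elem≡ (sym (ζ-hi u)))))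
                (ψ-c-top v (trans (ζ-hi u) tu))
                (sym3-reverse {R = K} (bbc v))
    where
    v = ζ u
    tv = trans (ζ-hi u) tu
    hi-ϱ⁻¹v = proj₂ (proj₂ spec v tv)
    lo-ϱ⁻¹v : lo (ϱ⁻¹ v) ≡ lo u
    lo-ϱ⁻¹v = trans (proj₁ (proj₂ spec v tv))
                    (trans (cong (λ m → n ∸ (m ∸ lo u)) tu) (m∸[m∸n]≡n (<⇒≤ (lo<n u))))
  ψ-maps-Z-bbc u (no ¬tu) =
    Sym3-resp K (ψ-b-low (loE u) (lo≢n u)) (ψ-b-low (hiE u) ¬tu)
                (ψ-c-low (ζ u) (λ e → ¬tu (trans (sym (ζ-hi u)) e)))
                (inj₁ (ccc _ _ (ζ u) (inj₂ (inj₁ (u , ¬Top⇒hi<n u ¬tu , refl , refl , refl , refl , refl)))))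

  two-top : ∀ {u v w} → IsLine N u v w → Top u → Top v → ¬ Top w → Sym3 K (b (loE u)) (b (loE v)) (c w)
  two-top {u} {v} {w} il tu tv ¬tw with <-cmp (lo u) (lo v)
  ... | tri< lu<lv _ _ =
    let s = pair (lo u) (lo v) (lo-pos′ u) lu<lv (<⇒≤ (lo<n v))
        s-line = proj₁ spec s u v (lo<n v) refl tu refl tv
    in Sym3-resp K refl refl (cong c (third-point-unique _≟P_ il (proj₂ s-line))) (inj₁ (bbc s))
  ... | tri≈ _ lu≡lv _ = ⊥-elim (proj₁ (IsLine-distinct il) (pair≡ lu≡lv (trans tu (sym tv))))
  ... | tri> _ _ lv<lu =
    let s = pair (lo v) (lo u) (lo-pos′ v) lv<lu (<⇒≤ (lo<n u))
        s-line = proj₁ spec s v u (lo<n u) refl tv refl tu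
    in Sym3-resp K refl refl (cong c (third-point-unique _≟P_ (IsLine-swap₁₂ il) (proj₂ s-line)))
                 (sym3-swap₁₂ {R = K} (inj₁ (bbc s)))

  ψ-maps-N-line : ∀ {u v w} → IsLine N u v w → Sym3 K (ψₙ (c u)) (ψₙ (c v)) (ψₙ (c w))
  ψ-maps-N-line {u} {v} {w} il = by-tops (hi u ≟ n) (hi v ≟ n) (hi w ≟ n)
    where
    by-tops : Dec (Top u) → Dec (Top v) → Dec (Top w) → Sym3 K (ψₙ (c u)) (ψₙ (c v)) (ψₙ (c w))
    by-tops (no ¬tu) (no ¬tv) (no ¬tw) =
      Sym3-resp K (ψ-c-low u ¬tu) (ψ-c-low v ¬tv) (ψ-c-low w ¬tw)
        (inj₁ (ccc u v w (inj₁ (il , ¬Top⇒hi<n u ¬tu , ¬Top⇒hi<n v ¬tv , ¬Top⇒hi<n w ¬tw))))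
    by-tops (yes tu) (yes tv) (no ¬tw) =
      Sym3-resp K (ψ-c-top u tu) (ψ-c-top v tv) (ψ-c-low w ¬tw) (two-top il tu tv ¬tw)
    by-tops (yes tu) (no ¬tv) (yes tw) =
      Sym3-resp K (ψ-c-top u tu) (ψ-c-low v ¬tv) (ψ-c-top w tw)
        (sym3-swap₂₃ {R = K} (two-top (IsLine-swap₂₃ il) tu tw ¬tv))
    by-tops (no ¬tu) (yes tv) (yes tw) =
      Sym3-resp K (ψ-c-low u ¬tu) (ψ-c-top v tv) (ψ-c-top w tw)
        (sym3-swap₁₂ {R = K} (sym3-swap₂₃ {R = K} (two-top (IsLine-swap₂₃ (IsLine-swap₁₂ il)) tv tw ¬tu)))
    by-tops (yes tu) (yes tv) (yes tw) = ⊥-elim (¬three-top il tu tv tw)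
    by-tops (yes tu) (no ¬tv) (no ¬tw) = ⊥-elim (¬one-top il tu ¬tv ¬tw)
    by-tops (no ¬tu) (yes tv) (no ¬tw) = ⊥-elim (¬one-top (IsLine-swap₁₂ il) tv ¬tu ¬tw)
    by-tops (no ¬tu) (no ¬tv) (yes tw) = ⊥-elim (¬one-top (IsLine-swap₁₂ (IsLine-swap₂₃ il)) tw ¬tu ¬tv)

  ψ-maps-Z-lines : ∀ {x y z} → Z x y z → Sym3 K (ψₙ x) (ψₙ y) (ψₙ z)
  ψ-maps-Z-lines (pab i) = ψ-preserves-pab ϱ (KLine n N) i
  ψ-maps-Z-lines (aac u) = ψ-preserves-aac ϱ (KLine n N) u
  ψ-maps-Z-lines (bbc u) = ψ-maps-Z-bbc u (hi u ≟ n)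
  ψ-maps-Z-lines (ccc u v w il) = ψ-maps-N-line il

  ψ-preserves-lines : ∀ x y z
    → ΠLine n ϱ (KLine n N) x y z ⇔ ΠLine n (ζ↔ n) (IsLine N) (ψₙ x) (ψₙ y) (ψₙ z)
  ψ-preserves-lines x y z = mk⇔
    (sym3-map {R = K} {S = Z} ψₙ ψ-maps-K-lines)
    (λ s → Sym3-resp K (sym (ψ-involutive x)) (sym (ψ-involutive y)) (sym (ψ-involutive z))
                       (sym3-map {R = Z} {S = K} ψₙ ψ-maps-Z-lines s))

proposition2p14 : (n : ℕ) → (h : 3 ≤ n) → (N : Config (Pair n))
    → IsConfiguration n N
    → FreelyContains N (λ u → hi u ≡ n)
    → Σ (Pair n ↔ Pair n) (RhoSpec n N)
      × ((ϱ : Pair n ↔ Pair n) → RhoSpec n N ϱ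
         → Bijective _≡_ _≡_ (ψ n (≤-trans (s≤s z≤n) h))
           × (∀ x y z → ΠLine n ϱ (KLine n N) x y z
                        ⇔ ΠLine n (ζ↔ n) (IsLine N) (ψ n (≤-trans (s≤s z≤n) h) x)
                            (ψ n (≤-trans (s≤s z≤n) h) y) (ψ n (≤-trans (s≤s z≤n) h) z)))
proposition2p14 n h N conf free =
  (ϱ , ϱ-spec) , λ ϱ′ ϱ′-spec → ψ-bijective , Correspondence.ψ-preserves-lines n h N conf free ϱ′ ϱ′-spec
  where
  open TopPairs n h N conf free using (ϱ; ϱ-spec)
  open Involution n (≤-trans (s≤s z≤n) h) using (ψ-bijective)
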